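{- Let $A$ be a totally ordered alphabet and $w$ a nonempty finite word over $A$. For each $i\in\{1,\dots,6\}$, the word $w$ is a Lyndon word if and only if condition $(i)$ below holds for every factorization $w=uv$ with $u,v$ nonempty: (1) $u^\omega<v^\omega$; (2) $(uv)^\omega<v^\omega$; (3) $u^\omega<(vu)^\omega$; (4) $(uv)^\omega<(vu)^\omega$; (5) $u^\omega<(uv)^\omega$; (6) $(vu)^\omega<v^\omega$.
   Context: The order $<$ on finite and infinite words is the lexicographical order induced by the order of $A$. For a nonempty finite word $x$, $x^\omega=xxx\cdots$. A nonempty word $w$ is a Lyndon word if for every factorization $w=uv$ with $u,v$ nonempty one has $w<v$ (equivalently $u<v$, equivalently $uv<vu$). -}

module Defs where

open import Level using (Level; _⊔_)
open import Data.Nat using (ℕ; _<_)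
open import Data.Nat.DivMod using (_mod_)
open import Data.Product using (Σ; ∃; _×_)
open import Data.List using (List; _++_)
import Data.List as List
open import Data.List.NonEmpty using (List⁺; _∷_; toList; length; _⁺++⁺_)
open import Data.List.Relation.Binary.Lex.Strict using (Lex-<)
open import Relation.Binary.Bundles using (StrictTotalOrder)
open import Relation.Binary.PropositionalEquality using (_≡_)

module Words {c ℓ₁ ℓ₂ : Level} (O : StrictTotalOrder c ℓ₁ ℓ₂) where
  open StrictTotalOrder O renaming (Carrier to A; _<_ to _≺_)

  -- finite words are lists over A; lexicographic order induced by ≺
  -- (a proper prefix is smaller)
  _<w_ : List A → List A → Set (c ⊔ ℓ₁ ⊔ ℓ₂)
  _<w_ = Lex-< _≈_ _≺_

  InfWord : Set c
  InfWord = ℕ → A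

  _<∞_ : InfWord → InfWord → Set (ℓ₁ ⊔ ℓ₂)
  s <∞ t = ∃ λ n → (∀ i → i < n → s i ≈ t i) × (s n ≺ t n)

  _^ω : List⁺ A → InfWord
  (x ^ω) n = List.lookup (toList x) (n mod length x)

  IsLyndon : List⁺ A → Set (c ⊔ ℓ₁ ⊔ ℓ₂)
  IsLyndon w = ∀ (u v : List⁺ A) → toList w ≡ toList u ++ toList v →
               toList w <w toList v

  data Idx : Set where
    c1 c2 c3 c4 c5 c6 : Idx

  Cond : Idx → List⁺ A → List⁺ A → Set (ℓ₁ ⊔ ℓ₂)
  Cond c1 u v = (u ^ω) <∞ (v ^ω)
  Cond c2 u v = ((u ⁺++⁺ v) ^ω) <∞ (v ^ω)
  Cond c3 u v = (u ^ω) <∞ ((v ⁺++⁺ u) ^ω)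
  Cond c4 u v = ((u ⁺++⁺ v) ^ω) <∞ ((v ⁺++⁺ u) ^ω)
  Cond c5 u v = (u ^ω) <∞ ((u ⁺++⁺ v) ^ω)
  Cond c6 u v = ((v ⁺++⁺ u) ^ω) <∞ (v ^ω)

-- Write xs ++∞ s for the infinite word s prefixed by the finite word xs.  For
-- nonempty x, x^ω is the unique fixed point of s ↦ x ++∞ s.  Two facts drive
-- the argument: prefixing by a common word neither creates nor destroys a strict
-- inequality, and x ++∞ s < s holds iff x^ω < s (dually for >).  Together with
-- (uv)^ω = u ++∞ (vu)^ω they reduce each of the six conditions to (4), which for
-- w = uv says w^ω < v ++∞ w^ω.  Since v is shorter than w, w < v is the same as
-- w ++∞ w^ω < v ++∞ w^ω unless v is a prefix of w; and if w = vz, the condition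
-- for the factorization v·z gives w^ω < z ++∞ w^ω, while cancelling v in
-- v ++∞ z ++∞ w^ω = w^ω < v ++∞ w^ω gives the opposite inequality.
module Submission where

open import Defs
open import Level using (Level; _⊔_)
open import Data.Empty using (⊥; ⊥-elim)
open import Data.Fin using (fromℕ<)
open import Data.Fin.Properties using (fromℕ<-cong)
open import Data.List using (List; []; _∷_; _++_; length; lookup)
open import Data.List.Properties using (length-++)
open import Data.List.NonEmpty as List⁺ using (List⁺; _∷_; toList; _⁺++⁺_)
open import Data.List.Relation.Binary.Lex.Core using (base; halt; this; next)
open import Data.List.Relation.Binary.Lex.Strict using (<-strictTotalOrder)
open import Data.List.Relation.Binary.Pointwise using (Pointwise; []; _∷_; Pointwise-length)
open import Data.Nat using (ℕ; zero; suc; _+_; _<_; s≤s)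
open import Data.Nat.DivMod using (_%_; m<n⇒m%n≡m; [m+n]%n≡m%n)
open import Data.Nat.Induction using (<-rec)
open import Data.Nat.Properties
  using (+-comm; <-≤-connex; m≤n⇒∃[o]m+o≡n; m≤m+n; m≤n+m; n<1+n
        ; <-≤-trans; <-trans; <-irrefl; <⇒≱; <-cmp)
open import Data.Product using (_,_)
open import Data.Sum using (inj₁; inj₂)
open import Function.Base using (_∘_)
open import Function.Bundles using (_⇔_; mk⇔; Equivalence)
open import Function.Related.Propositional using (module EquationalReasoning)
open import Function.Construct.Symmetry using (⇔-sym)
open import Relation.Binary.Bundles using (StrictTotalOrder)
open import Relation.Binary.Core using (Rel)
open import Relation.Binary.Definitions using (Reflexive; Transitive; tri<; tri≈; tri>)
import Relation.Binary.Construct.Flip.Ord as Flip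
open import Relation.Binary.PropositionalEquality
  using (_≡_; _≗_; refl; sym; trans; cong; subst; module ≡-Reasoning)

open Equivalence using (to; from)

data Offset (n : ℕ) : ℕ → Set where
  below  : ∀ {i} → i < n → Offset n i
  beyond : ∀ k → Offset n (n + k)

offset : ∀ n i → Offset n i
offset n i with <-≤-connex i n
... | inj₁ i<n = below i<n
... | inj₂ n≤i with m≤n⇒∃[o]m+o≡n n≤i
...   | k , refl = beyond k

module _ {a} {A : Set a} where

  infixr 5 _++∞_
  _++∞_ : List A → (ℕ → A) → ℕ → A
  ([]       ++∞ s) i       = s i
  ((x ∷ xs) ++∞ s) zero    = x
  ((x ∷ xs) ++∞ s) (suc i) = (xs ++∞ s) i

  ++∞-beyond : ∀ xs s k → (xs ++∞ s) (length xs + k) ≡ s k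
  ++∞-beyond []       s k = refl
  ++∞-beyond (x ∷ xs) s k = ++∞-beyond xs s k

  ++∞-below : ∀ xs s t {i} → i < length xs → (xs ++∞ s) i ≡ (xs ++∞ t) i
  ++∞-below (x ∷ xs) s t {zero}  _         = refl
  ++∞-below (x ∷ xs) s t {suc i} (s≤s i<n) = ++∞-below xs s t i<n

  ++∞-lookup : ∀ xs s {i} (i<n : i < length xs) → (xs ++∞ s) i ≡ lookup xs (fromℕ< i<n)
  ++∞-lookup (x ∷ xs) s {zero}  _         = refl
  ++∞-lookup (x ∷ xs) s {suc i} (s≤s i<n) = ++∞-lookup xs s i<n

  ++∞-cong : ∀ xs {s t} → s ≗ t → xs ++∞ s ≗ xs ++∞ t
  ++∞-cong []       s≗t i       = s≗t i
  ++∞-cong (x ∷ xs) s≗t zero    = refl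
  ++∞-cong (x ∷ xs) s≗t (suc i) = ++∞-cong xs s≗t i

  ++∞-assoc : ∀ xs ys s → (xs ++ ys) ++∞ s ≗ xs ++∞ ys ++∞ s
  ++∞-assoc []       ys s i       = refl
  ++∞-assoc (x ∷ xs) ys s zero    = refl
  ++∞-assoc (x ∷ xs) ys s (suc i) = ++∞-assoc xs ys s i

  AgreeBelow : ∀ {ℓ} → Rel A ℓ → ℕ → Rel (ℕ → A) ℓ
  AgreeBelow _∼_ n s t = ∀ i → i < n → s i ∼ t i

  ++∞-agree : ∀ {ℓ} (_∼_ : Rel A ℓ) → Reflexive _∼_ → ∀ xs {n s t} →
              AgreeBelow _∼_ n s t → AgreeBelow _∼_ (length xs + n) (xs ++∞ s) (xs ++∞ t)
  ++∞-agree _∼_ ∼-refl []       agree i       i<n       = agree i i<n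
  ++∞-agree _∼_ ∼-refl (x ∷ xs) agree zero    _         = ∼-refl
  ++∞-agree _∼_ ∼-refl (x ∷ xs) agree (suc i) (s≤s i<n) = ++∞-agree _∼_ ∼-refl xs agree i i<n

  Repeats : List A → (ℕ → A) → Set a
  Repeats xs f = f ≗ xs ++∞ f

  repeats-agree : ∀ {ℓ} (_∼_ : Rel A ℓ) → Transitive _∼_ → (x : List⁺ A) {f t : ℕ → A} {n : ℕ} →
                  Repeats (toList x) f → AgreeBelow _∼_ n (toList x ++∞ t) t → AgreeBelow _∼_ n f t
  repeats-agree _∼_ ∼-trans x@(_ ∷ xs) {f} {t} {n} f-rep agree =
    <-rec (λ i → i < n → f i ∼ t i) step
    where
    step : ∀ i → (∀ {j} → j < i → j < n → f j ∼ t j) → i < n → f i ∼ t i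
    step i rec i<n with offset (suc (length xs)) i
    ... | below i<x =
      subst (_∼ t i) (sym (trans (f-rep i) (++∞-below (toList x) f t i<x))) (agree i i<n)
    ... | beyond k = subst (_∼ t i) (sym (trans (f-rep i) (++∞-beyond (toList x) f k))) fₖ∼tᵢ
      where
      k<i : k < i
      k<i = s≤s (m≤n+m k (length xs))
      fₖ∼tᵢ : f k ∼ t i
      fₖ∼tᵢ = ∼-trans (subst (f k ∼_) (sym (++∞-beyond (toList x) t k)) (rec k<i (<-trans k<i i<n)))
                      (agree i i<n)

  repeats-unique : (x : List⁺ A) {f g : ℕ → A} → Repeats (toList x) f → Repeats (toList x) g → f ≗ g
  repeats-unique x f-rep g-rep i =
    repeats-agree _≡_ trans x f-rep (λ j _ → sym (g-rep j)) i (n<1+n i)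

  repeats-rotate : ∀ xs ys {g} → Repeats (ys ++ xs) g → Repeats (xs ++ ys) (xs ++∞ g)
  repeats-rotate xs ys {g} g-rep i = begin
    (xs ++∞ g) i                     ≡⟨ ++∞-cong xs g-rep i ⟩
    (xs ++∞ (ys ++ xs) ++∞ g) i      ≡⟨ ++∞-cong xs (++∞-assoc ys xs g) i ⟩
    (xs ++∞ ys ++∞ xs ++∞ g) i       ≡⟨ ++∞-assoc xs ys (xs ++∞ g) i ⟨
    ((xs ++ ys) ++∞ xs ++∞ g) i      ∎
    where open ≡-Reasoning

  suffix-shorter : ∀ {w u v : List⁺ A} → toList w ≡ toList u ++ toList v →
                   length (toList v) < length (toList w)
  suffix-shorter {u = _ ∷ us} {v} refl =
    subst (length (toList v) <_) (cong suc (sym (length-++ us))) (s≤s (m≤n+m _ (length us)))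

module Lex {c ℓ₁ ℓ₂} (O : StrictTotalOrder c ℓ₁ ℓ₂) where
  open StrictTotalOrder O
    using (_≈_; module Eq; irrefl; asym; <-respˡ-≈; <-respʳ-≈) renaming (Carrier to A)
  open Words O

  ^ω-below : (x : List⁺ A) {i : ℕ} (i<n : i < List⁺.length x) →
             (x ^ω) i ≡ lookup (toList x) (fromℕ< i<n)
  ^ω-below x {i} i<n = cong (lookup (toList x)) (fromℕ<-cong _ _ (m<n⇒m%n≡m i<n) _ i<n)

  ^ω-periodic : (x : List⁺ A) (k : ℕ) → (x ^ω) (List⁺.length x + k) ≡ (x ^ω) k
  ^ω-periodic x k = cong (lookup (toList x)) (fromℕ<-cong _ _ n+k%n≡k%n _ _)
    where
    n = List⁺.length x
    n+k%n≡k%n : (n + k) % n ≡ k % n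
    n+k%n≡k%n = trans (cong (_% n) (+-comm n k)) ([m+n]%n≡m%n k n)

  ^ω-repeats : (x : List⁺ A) → Repeats (toList x) (x ^ω)
  ^ω-repeats x i with offset (List⁺.length x) i
  ... | below i<n = trans (^ω-below x i<n) (sym (++∞-lookup (toList x) (x ^ω) i<n))
  ... | beyond k  = trans (^ω-periodic x k) (sym (++∞-beyond (toList x) (x ^ω) k))

  ^ω-unique : (x : List⁺ A) {f : InfWord} → Repeats (toList x) f → f ≗ x ^ω
  ^ω-unique x f-rep = repeats-unique x f-rep (^ω-repeats x)

  ^ω-rotate : (u v : List⁺ A) → (v ⁺++⁺ u) ^ω ≗ toList v ++∞ (u ⁺++⁺ v) ^ω
  ^ω-rotate u v i =
    sym (^ω-unique (v ⁺++⁺ u) (repeats-rotate (toList v) (toList u) (^ω-repeats (u ⁺++⁺ v))) i)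

  _≈∞_ : Rel InfWord ℓ₁
  s ≈∞ t = ∀ i → s i ≈ t i

  ++∞-resp-≋ : ∀ {xs ys} s → Pointwise _≈_ xs ys → (xs ++∞ s) ≈∞ (ys ++∞ s)
  ++∞-resp-≋ s []            i       = Eq.refl
  ++∞-resp-≋ s (x≈y ∷ xs≋ys) zero    = x≈y
  ++∞-resp-≋ s (x≈y ∷ xs≋ys) (suc i) = ++∞-resp-≋ s xs≋ys i

  <∞-resp-≈∞ : ∀ {s s′ t t′} → s ≈∞ s′ → t ≈∞ t′ → s <∞ t → s′ <∞ t′
  <∞-resp-≈∞ s≈s′ t≈t′ (n , agree , sₙ≺tₙ) =
    n , (λ i i<n → Eq.trans (Eq.sym (s≈s′ i)) (Eq.trans (agree i i<n) (t≈t′ i))) ,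
    <-respʳ-≈ (t≈t′ n) (<-respˡ-≈ (s≈s′ n) sₙ≺tₙ)

  <∞-cong : ∀ {s s′ t t′} → s ≗ s′ → t ≗ t′ → (s <∞ t) ⇔ (s′ <∞ t′)
  <∞-cong s≗s′ t≗t′ = mk⇔ (<∞-resp-≈∞ (Eq.reflexive ∘ s≗s′) (Eq.reflexive ∘ t≗t′))
                          (<∞-resp-≈∞ (Eq.reflexive ∘ sym ∘ s≗s′) (Eq.reflexive ∘ sym ∘ t≗t′))

  <∞-asym : ∀ {s t} → s <∞ t → t <∞ s → ⊥
  <∞-asym (m , agreeₘ , sₘ≺tₘ) (n , agreeₙ , tₙ≺sₙ) with <-cmp m n
  ... | tri< m<n _ _ = irrefl (Eq.sym (agreeₙ m m<n)) sₘ≺tₘ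
  ... | tri≈ _ refl _ = asym sₘ≺tₘ tₙ≺sₙ
  ... | tri> _ _ n<m = irrefl (Eq.sym (agreeₘ n n<m)) tₙ≺sₙ

  <∞-∷ : ∀ {x y xs ys s t} → x ≈ y → (xs ++∞ s) <∞ (ys ++∞ t) → ((x ∷ xs) ++∞ s) <∞ ((y ∷ ys) ++∞ t)
  <∞-∷ x≈y (n , agree , r) = suc n , agree′ , r
    where
    agree′ : AgreeBelow _≈_ (suc n) _ _
    agree′ zero    _         = x≈y
    agree′ (suc i) (s≤s i<n) = agree i i<n

  ++∞-cancel : ∀ xs {s t} → ((xs ++∞ s) <∞ (xs ++∞ t)) ⇔ (s <∞ t)
  ++∞-cancel xs = mk⇔ (cancel xs) (prepend xs)
    where
    cancel : ∀ xs {s t} → (xs ++∞ s) <∞ (xs ++∞ t) → s <∞ t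
    cancel []       lt                  = lt
    cancel (x ∷ xs) (zero , _ , x≺x)    = ⊥-elim (irrefl Eq.refl x≺x)
    cancel (x ∷ xs) (suc n , agree , r) = cancel xs (n , (λ i i<n → agree (suc i) (s≤s i<n)) , r)
    prepend : ∀ xs {s t} → s <∞ t → (xs ++∞ s) <∞ (xs ++∞ t)
    prepend []       lt = lt
    prepend (x ∷ xs) lt = <∞-∷ Eq.refl (prepend xs lt)

  -- f and x ++∞ s agree with s on the same initial segment, and at its end f
  -- still agrees with x ++∞ s, since both are x followed by words agreeing there.
  prepend-<∞⇔repeat-<∞ : (x : List⁺ A) {f s : InfWord} → Repeats (toList x) f →
                         ((toList x ++∞ s) <∞ s) ⇔ (f <∞ s)
  prepend-<∞⇔repeat-<∞ x@(_ ∷ xs) {f} {s} f-rep = mk⇔ to′ from′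
    where
    X : List A
    X = toList x
    n<X+n : ∀ n → n < length X + n
    n<X+n n = s≤s (m≤n+m n (length xs))
    to′ : (X ++∞ s) <∞ s → f <∞ s
    to′ (n , agree , r) = n , agreeᶠ , <-respˡ-≈ Xsₙ≈fₙ r
      where
      agreeᶠ : AgreeBelow _≈_ n f s
      agreeᶠ = repeats-agree _≈_ Eq.trans x f-rep agree
      Xsₙ≈fₙ : (X ++∞ s) n ≈ f n
      Xsₙ≈fₙ = Eq.sym (Eq.trans (Eq.reflexive (f-rep n))
                                (++∞-agree _≈_ Eq.refl X agreeᶠ n (n<X+n n)))
    from′ : f <∞ s → (X ++∞ s) <∞ s
    from′ (n , agree , r) = n , agree′ , <-respˡ-≈ fₙ≈Xsₙ r
      where
      agreeˣ : AgreeBelow _≈_ (length X + n) (X ++∞ f) (X ++∞ s)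
      agreeˣ = ++∞-agree _≈_ Eq.refl X agree
      agree′ : AgreeBelow _≈_ n (X ++∞ s) s
      agree′ i i<n = Eq.trans (Eq.sym (agreeˣ i (<-≤-trans i<n (m≤n+m n (length X)))))
                              (Eq.trans (Eq.reflexive (sym (f-rep i))) (agree i i<n))
      fₙ≈Xsₙ : f n ≈ (X ++∞ s) n
      fₙ≈Xsₙ = Eq.trans (Eq.reflexive (f-rep n)) (agreeˣ n (n<X+n n))

  data LexView (xs ys : List A) : Set (c ⊔ ℓ₁ ⊔ ℓ₂) where
    prefix   : ∀ xs′ (zs : List⁺ A) → Pointwise _≈_ xs xs′ → ys ≡ xs′ ++ toList zs → LexView xs ys
    mismatch : (∀ s t → (xs ++∞ s) <∞ (ys ++∞ t)) → LexView xs ys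

  lexView : ∀ {xs ys} → xs <w ys → LexView xs ys
  lexView (base ())
  lexView (halt {y} {ys})   = prefix [] (y ∷ ys) [] refl
  lexView (this x≺y)        = mismatch λ _ _ → zero , (λ _ ()) , x≺y
  lexView (next x≈y xs<ys) with lexView xs<ys
  ... | prefix xs′ zs xs≋xs′ refl = prefix (_ ∷ xs′) zs (x≈y ∷ xs≋xs′) refl
  ... | mismatch differ           = mismatch λ s t → <∞-∷ x≈y (differ s t)

  <w-shorter⇒<∞ : ∀ {xs ys} → length ys < length xs → xs <w ys → ∀ s t → (xs ++∞ s) <∞ (ys ++∞ t)
  <w-shorter⇒<∞ {xs} ys<xs xs<ys with lexView xs<ys
  ... | mismatch differ = differ
  ... | prefix xs′ zs xs≋xs′ refl = ⊥-elim (<⇒≱ ys<xs xs≤ys)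
    where
    open Data.Nat.Properties.≤-Reasoning
    xs≤ys = begin
      length xs                         ≡⟨ Pointwise-length xs≋xs′ ⟩
      length xs′                        ≤⟨ m≤m+n _ _ ⟩
      length xs′ + length (toList zs)   ≡⟨ length-++ xs′ ⟨
      length (xs′ ++ toList zs)         ∎

module Conditions {c ℓ₁ ℓ₂} (O : StrictTotalOrder c ℓ₁ ℓ₂) where
  open StrictTotalOrder O using (module Eq) renaming (Carrier to A)
  open Words O
  open Lex O
  open EquationalReasoning

  -- In the reversed order (both ≈ and ≺ flipped), s <∞ t unfolds to t <∞ s.
  <∞-prepend⇔<∞-repeat : (x : List⁺ A) {f s : InfWord} → Repeats (toList x) f →
                         (s <∞ (toList x ++∞ s)) ⇔ (s <∞ f)
  <∞-prepend⇔<∞-repeat = Lex.prepend-<∞⇔repeat-<∞ (Flip.strictTotalOrder O)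

  module _ (u v : List⁺ A) where
    private
      U V : List A
      U = toList u
      V = toList v
      uᵚ vᵚ uvᵚ vuᵚ : InfWord
      uᵚ = u ^ω
      vᵚ = v ^ω
      uvᵚ = (u ⁺++⁺ v) ^ω
      vuᵚ = (v ⁺++⁺ u) ^ω

    cond4⇔cond3 : Cond c4 u v ⇔ Cond c3 u v
    cond4⇔cond3 = begin
      uvᵚ <∞ vuᵚ           ∼⟨ <∞-cong (^ω-rotate v u) (λ _ → refl) ⟩
      (U ++∞ vuᵚ) <∞ vuᵚ   ∼⟨ prepend-<∞⇔repeat-<∞ u (^ω-repeats u) ⟩
      uᵚ <∞ vuᵚ            ∎

    cond5⇔cond3 : Cond c5 u v ⇔ Cond c3 u v
    cond5⇔cond3 = begin
      uᵚ <∞ uvᵚ                   ∼⟨ <∞-cong (^ω-repeats u) (^ω-rotate v u) ⟩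
      (U ++∞ uᵚ) <∞ (U ++∞ vuᵚ)   ∼⟨ ++∞-cancel U ⟩
      uᵚ <∞ vuᵚ                   ∎

    cond2⇔cond4 : Cond c2 u v ⇔ Cond c4 u v
    cond2⇔cond4 = begin
      uvᵚ <∞ vᵚ            ∼⟨ ⇔-sym (<∞-prepend⇔<∞-repeat v (^ω-repeats v)) ⟩
      uvᵚ <∞ (V ++∞ uvᵚ)   ∼⟨ <∞-cong (λ _ → refl) (sym ∘ ^ω-rotate u v) ⟩
      uvᵚ <∞ vuᵚ           ∎

    cond6⇔cond2 : Cond c6 u v ⇔ Cond c2 u v
    cond6⇔cond2 = begin
      vuᵚ <∞ vᵚ                   ∼⟨ <∞-cong (^ω-rotate u v) (^ω-repeats v) ⟩
      (V ++∞ uvᵚ) <∞ (V ++∞ vᵚ)   ∼⟨ ++∞-cancel V ⟩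
      uvᵚ <∞ vᵚ                   ∎

    cond1⇔cond5 : Cond c1 u v ⇔ Cond c5 u v
    cond1⇔cond5 = begin
      uᵚ <∞ vᵚ                          ∼⟨ ⇔-sym (<∞-prepend⇔<∞-repeat v (^ω-repeats v)) ⟩
      uᵚ <∞ (V ++∞ uᵚ)                  ∼⟨ ⇔-sym (++∞-cancel U) ⟩
      (U ++∞ uᵚ) <∞ (U ++∞ V ++∞ uᵚ)    ∼⟨ <∞-cong (sym ∘ ^ω-repeats u) (sym ∘ ++∞-assoc U V uᵚ) ⟩
      uᵚ <∞ ((U ++ V) ++∞ uᵚ)           ∼⟨ <∞-prepend⇔<∞-repeat (u ⁺++⁺ v) (^ω-repeats (u ⁺++⁺ v)) ⟩
      uᵚ <∞ uvᵚ                         ∎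

  cond⇔cond4 : ∀ i u v → Cond i u v ⇔ Cond c4 u v
  cond⇔cond4 c1 u v = begin
    Cond c1 u v ∼⟨ cond1⇔cond5 u v ⟩
    Cond c5 u v ∼⟨ cond5⇔cond3 u v ⟩
    Cond c3 u v ∼⟨ ⇔-sym (cond4⇔cond3 u v) ⟩
    Cond c4 u v ∎
  cond⇔cond4 c2 u v = cond2⇔cond4 u v
  cond⇔cond4 c3 u v = ⇔-sym (cond4⇔cond3 u v)
  cond⇔cond4 c4 u v = Cond c4 u v ∎
  cond⇔cond4 c5 u v = begin
    Cond c5 u v ∼⟨ cond5⇔cond3 u v ⟩
    Cond c3 u v ∼⟨ ⇔-sym (cond4⇔cond3 u v) ⟩
    Cond c4 u v ∎
  cond⇔cond4 c6 u v = begin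
    Cond c6 u v ∼⟨ cond6⇔cond2 u v ⟩
    Cond c2 u v ∼⟨ cond2⇔cond4 u v ⟩
    Cond c4 u v ∎

  cond4⇔^ω<∞ : ∀ {w u v} → toList w ≡ toList u ++ toList v →
               Cond c4 u v ⇔ ((w ^ω) <∞ (toList v ++∞ w ^ω))
  cond4⇔^ω<∞ {w} {u} {v} w≡uv = <∞-cong uvᵚ≗wᵚ vuᵚ≗v++wᵚ
    where
    uvᵚ≗wᵚ : (u ⁺++⁺ v) ^ω ≗ w ^ω
    uvᵚ≗wᵚ i = sym (^ω-unique (u ⁺++⁺ v) (subst (λ xs → Repeats xs (w ^ω)) w≡uv (^ω-repeats w)) i)
    vuᵚ≗v++wᵚ : (v ⁺++⁺ u) ^ω ≗ toList v ++∞ w ^ω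
    vuᵚ≗v++wᵚ i = trans (^ω-rotate u v i) (++∞-cong (toList v) uvᵚ≗wᵚ i)

  cond⇔^ω<∞ : ∀ i {w u v} → toList w ≡ toList u ++ toList v →
              Cond i u v ⇔ ((w ^ω) <∞ (toList v ++∞ w ^ω))
  cond⇔^ω<∞ i {w} {u} {v} w≡uv = begin
    Cond i u v                       ∼⟨ cond⇔cond4 i u v ⟩
    Cond c4 u v                      ∼⟨ cond4⇔^ω<∞ w≡uv ⟩
    (w ^ω) <∞ (toList v ++∞ w ^ω)    ∎

  lyndon⇔^ω<∞ : ∀ {w} → IsLyndon w ⇔
                (∀ u v → toList w ≡ toList u ++ toList v → (w ^ω) <∞ (toList v ++∞ w ^ω))
  lyndon⇔^ω<∞ {w} = mk⇔ lyndon⇒ ⇒lyndon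
    where
    wᵚ : InfWord
    wᵚ = w ^ω

    lyndon⇒ : IsLyndon w → ∀ u v → toList w ≡ toList u ++ toList v → wᵚ <∞ (toList v ++∞ wᵚ)
    lyndon⇒ lyndon u v w≡uv =
      to (<∞-cong (sym ∘ ^ω-repeats w) (λ _ → refl))
         (<w-shorter⇒<∞ (suffix-shorter w≡uv) (lyndon u v w≡uv) wᵚ wᵚ)

    ⇒lyndon : (∀ u v → toList w ≡ toList u ++ toList v → wᵚ <∞ (toList v ++∞ wᵚ)) → IsLyndon w
    ⇒lyndon cond u v w≡uv with StrictTotalOrder.compare (<-strictTotalOrder O) (toList w) (toList v)
    ... | tri< w<v _ _ = w<v
    ... | tri≈ _ w≋v _ = ⊥-elim (<-irrefl (sym (Pointwise-length w≋v)) (suffix-shorter w≡uv))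
    ... | tri> _ _ v<w with lexView v<w
    ...   | mismatch differ =
      ⊥-elim (<∞-asym (cond u v w≡uv)
                      (to (<∞-cong (λ _ → refl) (sym ∘ ^ω-repeats w)) (differ wᵚ wᵚ)))
    ...   | prefix (b ∷ bs) z v≋x w≡xz = ⊥-elim (<∞-asym (cond (b ∷ bs) z w≡xz) z++wᵚ<wᵚ)
      where
      x : List A
      x = b ∷ bs
      wᵚ≗x++z++wᵚ : wᵚ ≗ x ++∞ toList z ++∞ wᵚ
      wᵚ≗x++z++wᵚ i = trans (^ω-repeats w i)
                        (trans (cong (λ xs → (xs ++∞ wᵚ) i) w≡xz) (++∞-assoc x (toList z) wᵚ i))
      z++wᵚ<wᵚ : (toList z ++∞ wᵚ) <∞ wᵚ
      z++wᵚ<wᵚ = to (++∞-cancel x)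
        (<∞-resp-≈∞ (Eq.reflexive ∘ wᵚ≗x++z++wᵚ) (++∞-resp-≋ wᵚ v≋x) (cond u v w≡uv))

theorem2 : {c ℓ₁ ℓ₂ : Level} (O : StrictTotalOrder c ℓ₁ ℓ₂) →
    (i : Words.Idx O) (w : List⁺ (StrictTotalOrder.Carrier O)) →
    Words.IsLyndon O w ⇔
      (∀ (u v : List⁺ (StrictTotalOrder.Carrier O)) →
        toList w ≡ toList u ++ toList v → Words.Cond O i u v)
theorem2 O i w = mk⇔
  (λ lyndon u v w≡uv → from (cond⇔^ω<∞ i w≡uv) (to lyndon⇔^ω<∞ lyndon u v w≡uv))
  (λ conds → from lyndon⇔^ω<∞ λ u v w≡uv → to (cond⇔^ω<∞ i w≡uv) (conds u v w≡uv))
  where open Conditions O
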